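{- For every positive integer $k$ there exists a graph $G$ such that $\Gamma_{\rho}(G)-\chi_{\rho}(G)\ge k$.
   Context: $d(u,v)$ is graph distance. A packing $k$-coloring is a map $c:V(G)\to\{1,\dots,k\}$ such that $c(u)=c(v)=i$, $u\ne v$, implies $d(u,v)>i$; $\chi_{\rho}(G)$ is the smallest $k$ for which a packing $k$-coloring exists. The Grundy packing chromatic number $\Gamma_{\rho}(G)$ is the maximum number of colors $k$ in a packing coloring $c:V(G)\to\{1,\dots,k\}$ using all $k$ colors in which every vertex $v$ with $c(v)=i$ has, for every $j\in\{1,\dots,i-1\}$, a vertex $u$ with $c(u)=j$ and $d(u,v)\le j$ (equivalently, the maximum number of colors produced by the greedy procedure that processes vertices in some order and assigns each vertex the smallest color $i$ with no already-colored vertex of color $i$ at distance at most $i$). -}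

module Defs where

open import Data.Nat using (ℕ; zero; suc; _≤_; _<_)
open import Data.Fin using (Fin)
open import Data.Bool using (Bool; true; false)
open import Data.Product using (Σ; _×_; ∃; ∃-syntax)
open import Relation.Binary.PropositionalEquality using (_≡_; _≢_)
open import Relation.Nullary using (¬_)

record Graph : Set where
  field
    n     : ℕ
    adj   : Fin n → Fin n → Bool
    sym   : ∀ u v → adj u v ≡ adj v u
    irrefl : ∀ v → adj v v ≡ false

open Graph public

-- Within G m u v  :  d_G(u,v) ≤ m, i.e. there is a walk of length at most m from u to v.
data Within (G : Graph) : ℕ → Fin (n G) → Fin (n G) → Set where
  here : ∀ {m v} → Within G m v v
  step : ∀ {m u w v} → adj G u w ≡ true → Within G m w v → Within G (suc m) u v

record IsPackingColoring (G : Graph) (k : ℕ) (c : Fin (n G) → ℕ) : Set where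
  field
    range   : ∀ v → 1 ≤ c v × c v ≤ k
    packing : ∀ u v → u ≢ v → c u ≡ c v → ¬ Within G (c u) u v

IsPackingChromaticNumber : Graph → ℕ → Set
IsPackingChromaticNumber G k =
  (∃[ c ] IsPackingColoring G k c) ×
  (∀ k′ → k′ < k → ¬ (∃[ c ] IsPackingColoring G k′ c))

record IsGrundyPackingColoring (G : Graph) (k : ℕ) (c : Fin (n G) → ℕ) : Set where
  field
    packingColoring : IsPackingColoring G k c
    allUsed : ∀ i → 1 ≤ i → i ≤ k → ∃[ v ] c v ≡ i
    grundy  : ∀ v j → 1 ≤ j → j < c v → ∃[ u ] (c u ≡ j × Within G j u v)

IsGrundyPackingChromaticNumber : Graph → ℕ → Set
IsGrundyPackingChromaticNumber G k =
  (∃[ c ] IsGrundyPackingColoring G k c) ×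
  (∀ k′ → k < k′ → ¬ (∃[ c ] IsGrundyPackingColoring G k′ c))

{-# OPTIONS --safe #-}
-- The star with k + 1 leaves separates the two invariants. Its centre is adjacent
-- to every leaf and any two vertices are at distance at most 2, so colouring the
-- vertices 1, 2, …, k + 2 with colour 1 on the centre is a Grundy packing colouring;
-- since the colours of a Grundy colouring are all used, no Grundy colouring has
-- more colours than vertices, so Γ_ρ = k + 2. Colouring the centre 2 and the
-- pairwise non-adjacent leaves 1 is a packing colouring, and an edge rules out a
-- single colour, so χ_ρ = 2.
module Submission where

open import Defs
open import Data.Nat using (ℕ; zero; suc; _≤_; _<_; _+_; z≤n; s≤s)
open import Data.Nat.Properties using (≤-refl; ≤-trans; ≤-antisym; <⇒≤; <⇒≱; suc-injective)
open import Data.Fin as Fin using (Fin; toℕ; fromℕ<)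
open import Data.Fin.Properties using (toℕ-injective; toℕ-fromℕ<; toℕ<n; injective⇒≤)
open import Data.Bool using (Bool; true; false)
open import Data.Product using (_×_; _,_; proj₁; proj₂; ∃-syntax)
open import Data.Empty using (⊥-elim)
open import Function using (_∘_)
open import Function.Definitions using (Injective)
open import Relation.Binary.PropositionalEquality using (_≡_; _≢_; refl; trans; cong; subst)
  renaming (sym to ≡-sym)
open import Relation.Nullary using (¬_)

module _ {G : Graph} where

  Within-mono : ∀ {m m′ u v} → m ≤ m′ → Within G m u v → Within G m′ u v
  Within-mono _          here       = here
  Within-mono (s≤s m≤m′) (step e w) = step e (Within-mono m≤m′ w)

  Within-1⇒adj : ∀ {u v} → u ≢ v → Within G 1 u v → adj G u v ≡ true
  Within-1⇒adj u≢v here          = ⊥-elim (u≢v refl)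
  Within-1⇒adj _   (step e here) = e

  injective⇒packingColoring : ∀ {k c} → (∀ v → 1 ≤ c v × c v ≤ k) → Injective _≡_ _≡_ c →
                              IsPackingColoring G k c
  injective⇒packingColoring range inj = record
    { range   = range
    ; packing = λ u v u≢v cu≡cv _ → u≢v (inj cu≡cv) }

  grundyColoring⇒≤order : ∀ {k c} → IsGrundyPackingColoring G k c → k ≤ n G
  grundyColoring⇒≤order {k} {c} g = injective⇒≤ {f = vertexOf} vertexOf-injective
    where
    open IsGrundyPackingColoring g

    colourOf : ∀ (i : Fin k) → ∃[ v ] c v ≡ suc (toℕ i)
    colourOf i = allUsed (suc (toℕ i)) (s≤s z≤n) (toℕ<n i)

    vertexOf : Fin k → Fin (n G)
    vertexOf = proj₁ ∘ colourOf

    vertexOf-injective : Injective _≡_ _≡_ vertexOf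
    vertexOf-injective {i} {j} eq = toℕ-injective (suc-injective
      (trans (≡-sym (proj₂ (colourOf i))) (trans (cong c eq) (proj₂ (colourOf j)))))

  grundyColoring-of-order⇒Γ : ∀ {c} → IsGrundyPackingColoring G (n G) c →
                              IsGrundyPackingChromaticNumber G (n G)
  grundyColoring-of-order⇒Γ {c} g =
    (c , g) , λ k′ n<k′ (c′ , g′) → <⇒≱ n<k′ (grundyColoring⇒≤order g′)

  adjacent⇒distinct : ∀ {u v} → adj G u v ≡ true → u ≢ v
  adjacent⇒distinct {u} e refl with trans (≡-sym e) (irrefl G u)
  ... | ()

  adjacent⇒¬packingColoring<2 : ∀ {u v k c} → adj G u v ≡ true → k < 2 → ¬ IsPackingColoring G k c
  adjacent⇒¬packingColoring<2 {u} {k = zero} _ _ p =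
    <⇒≱ (s≤s z≤n) (≤-trans (proj₁ (range u)) (proj₂ (range u)))
    where open IsPackingColoring p
  adjacent⇒¬packingColoring<2 {u} {v} {suc zero} {c} e _ p =
    packing u v (adjacent⇒distinct e) (trans (one u) (≡-sym (one v)))
      (subst (λ i → Within G i u v) (≡-sym (one u)) (step e here))
    where
    open IsPackingColoring p
    one : ∀ w → c w ≡ 1
    one w = ≤-antisym (proj₂ (range w)) (proj₁ (range w))
  adjacent⇒¬packingColoring<2 {k = suc (suc _)} _ (s≤s (s≤s ())) _

  packingColoring-of-edge⇒χ≡2 : ∀ {u v c} → adj G u v ≡ true → IsPackingColoring G 2 c →
                                IsPackingChromaticNumber G 2
  packingColoring-of-edge⇒χ≡2 e p = (_ , p) , λ k′ k′<2 (c′ , p′) → adjacent⇒¬packingColoring<2 e k′<2 p′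

starAdj : ∀ {m} → Fin (suc m) → Fin (suc m) → Bool
starAdj Fin.zero    Fin.zero    = false
starAdj Fin.zero    (Fin.suc _) = true
starAdj (Fin.suc _) Fin.zero    = true
starAdj (Fin.suc _) (Fin.suc _) = false

starAdj-sym : ∀ {m} (u v : Fin (suc m)) → starAdj u v ≡ starAdj v u
starAdj-sym Fin.zero    Fin.zero    = refl
starAdj-sym Fin.zero    (Fin.suc _) = refl
starAdj-sym (Fin.suc _) Fin.zero    = refl
starAdj-sym (Fin.suc _) (Fin.suc _) = refl

starAdj-irrefl : ∀ {m} (v : Fin (suc m)) → starAdj v v ≡ false
starAdj-irrefl Fin.zero    = refl
starAdj-irrefl (Fin.suc _) = refl

star : ℕ → Graph
star m = record { n = suc m ; adj = starAdj ; sym = starAdj-sym ; irrefl = starAdj-irrefl }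

module _ (m : ℕ) where

  centre-within-1 : ∀ v → Within (star m) 1 Fin.zero v
  centre-within-1 Fin.zero    = here
  centre-within-1 (Fin.suc _) = step refl here

  star-within-2 : ∀ u v → Within (star m) 2 u v
  star-within-2 Fin.zero    v = Within-mono (s≤s z≤n) (centre-within-1 v)
  star-within-2 (Fin.suc _) v = step refl (centre-within-1 v)

  distinctColouring : Fin (suc m) → ℕ
  distinctColouring = suc ∘ toℕ

  distinctColouring-onto : ∀ i → 1 ≤ i → i ≤ suc m → ∃[ v ] distinctColouring v ≡ i
  distinctColouring-onto (suc i) _ i<1+m = fromℕ< i<1+m , cong suc (toℕ-fromℕ< i<1+m)

  within-distinctColouring : ∀ u v → Within (star m) (distinctColouring u) u v
  within-distinctColouring Fin.zero    v = centre-within-1 v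
  within-distinctColouring (Fin.suc u) v = Within-mono (s≤s (s≤s z≤n)) (star-within-2 (Fin.suc u) v)

  distinctColouring-grundy : IsGrundyPackingColoring (star m) (suc m) distinctColouring
  distinctColouring-grundy = record
    { packingColoring = injective⇒packingColoring (λ v → s≤s z≤n , toℕ<n v) (toℕ-injective ∘ suc-injective)
    ; allUsed         = distinctColouring-onto
    ; grundy          = grundy }
    where
    grundy : ∀ v j → 1 ≤ j → j < distinctColouring v →
             ∃[ u ] (distinctColouring u ≡ j × Within (star m) j u v)
    grundy v j 1≤j j<cv with distinctColouring-onto j 1≤j (≤-trans (<⇒≤ j<cv) (toℕ<n v))
    ... | u , cu≡j = u , cu≡j , subst (λ i → Within (star m) i u v) cu≡j (within-distinctColouring u v)

  centreTwoColouring : Fin (suc m) → ℕ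
  centreTwoColouring Fin.zero    = 2
  centreTwoColouring (Fin.suc _) = 1

  centreTwoColouring-packing : IsPackingColoring (star m) 2 centreTwoColouring
  centreTwoColouring-packing = record { range = range ; packing = packing }
    where
    range : ∀ v → 1 ≤ centreTwoColouring v × centreTwoColouring v ≤ 2
    range Fin.zero    = s≤s z≤n , ≤-refl
    range (Fin.suc _) = s≤s z≤n , s≤s z≤n

    packing : ∀ u v → u ≢ v → centreTwoColouring u ≡ centreTwoColouring v →
              ¬ Within (star m) (centreTwoColouring u) u v
    packing Fin.zero    Fin.zero    u≢v _  _ = u≢v refl
    packing Fin.zero    (Fin.suc _) _   () _
    packing (Fin.suc _) Fin.zero    _   () _
    packing (Fin.suc _) (Fin.suc _) u≢v _ w with Within-1⇒adj u≢v w
    ... | ()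

proposition17 : (k : ℕ) → 1 ≤ k →
    ∃[ G ] ∃[ γ ] ∃[ χ ] (IsGrundyPackingChromaticNumber G γ × IsPackingChromaticNumber G χ × χ + k ≤ γ)
proposition17 k _ = star (suc k) , suc (suc k) , 2 ,
  grundyColoring-of-order⇒Γ (distinctColouring-grundy (suc k)) ,
  packingColoring-of-edge⇒χ≡2 {u = Fin.zero} {v = Fin.suc Fin.zero} refl (centreTwoColouring-packing (suc k)) ,
  ≤-refl
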